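{- Let $G$ be a graph and $i\in\{1,\dots,\gamma_P(G)-1\}$. If $\mathrm{MObs}(G;i)\le\mathrm{MObs}(G;i+1)$, then $i$ is not a useful size for $G$.
   Context: Graphs are finite and simple. Power domination: from $S\subseteq V(G)$, first $N[S]$ is observed; then repeatedly, while an observed vertex has exactly one unobserved neighbor, that neighbor becomes observed; the final set is $\mathrm{Obs}(G;S)$. $\gamma_P(G)$ is the least $|S|$ with $\mathrm{Obs}(G;S)=V(G)$. $\mathrm{maxObs}(G;k):=\max_{|S|=k}|\mathrm{Obs}(G;S)|$ and $\mathrm{MObs}(G;k):=\mathrm{maxObs}(G;k)-\mathrm{maxObs}(G;k-1)$ for $k\in\{1,\dots,\gamma_P(G)\}$. For $\beta\ge0$, $\mathrm{C}(G;S,\beta)=|S|+\beta(|V(G)|-|\mathrm{Obs}(G;S)|)$; $S$ is $\beta$-best if it minimizes $\mathrm{C}(G;\cdot,\beta)$ over all subsets of $V(G)$. A set $S$ is useful if there is a non-degenerate interval $I$ such that $S$ is $\beta$-best for all $\beta\in I$; an integer $k\in\{0,\dots,\gamma_P(G)\}$ is a useful size if some useful set has size $k$. -}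

module Defs where

open import Data.Nat using (ℕ; zero; suc; _⊔_; _≤_)
open import Data.Bool using (Bool; true; false; _∨_; _∧_; not)
open import Data.Fin using (Fin; _≟_)
open import Data.Fin.Subset using (Subset; ∣_∣)
open import Data.Vec using (Vec; []; _∷_; lookup; tabulate)
open import Data.List using (List; [_]; _++_; map; filter; foldr; allFin)
open import Data.Bool.ListAction using (any; all)
open import Data.Product using (Σ; _×_; _,_)
open import Data.Integer using (ℤ; +_) renaming (_-_ to _-ℤ_)
open import Data.Rational using (ℚ; _/_; 0ℚ) renaming (_+_ to _+ℚ_; _*_ to _*ℚ_; _≤_ to _≤ℚ_; _<_ to _<ℚ_)
open import Relation.Binary.PropositionalEquality using (_≡_)
open import Relation.Nullary.Decidable using (⌊_⌋)
open import Function using (_∘_)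

record Graph : Set where
  field
    n      : ℕ
    adj    : Fin n → Fin n → Bool
    sym    : ∀ u v → adj u v ≡ adj v u
    irrefl : ∀ v → adj v v ≡ false

module _ (G : Graph) where
  open Graph G

  anyV : (Fin n → Bool) → Bool
  anyV p = any p (allFin n)

  allV : (Fin n → Bool) → Bool
  allV p = all p (allFin n)

  closedNbhd : Subset n → Subset n
  closedNbhd S = tabulate λ w → lookup S w ∨ anyV (λ v → lookup S v ∧ adj v w)

  -- one (parallel) propagation round: w becomes observed if some observed v
  -- adjacent to w has all its neighbours other than w observed
  -- (i.e. w is the unique unobserved neighbour of v, or w is already observed).
  propStep : Subset n → Subset n
  propStep O = tabulate λ w → lookup O w ∨
    anyV (λ v → lookup O v ∧ adj v w ∧
                allV (λ u → not (adj v u) ∨ ⌊ u ≟ w ⌋ ∨ lookup O u))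

  iter : ℕ → Subset n → Subset n
  iter zero O = O
  iter (suc k) O = iter k (propStep O)

  -- Obs(G;S): the propagation saturates after at most n rounds
  Obs : Subset n → Subset n
  Obs S = iter n (closedNbhd S)

  allSubsets : (m : ℕ) → List (Subset m)
  allSubsets zero = [ [] ]
  allSubsets (suc m) = map (true ∷_) (allSubsets m) ++ map (false ∷_) (allSubsets m)

  maxObs : ℕ → ℕ
  maxObs k = foldr _⊔_ 0
    (map (λ S → ∣ Obs S ∣) (filter (λ S → ∣ S ∣ Data.Nat.≟ k) (allSubsets n)))

  MObs : ℕ → ℤ
  MObs zero = + 0
  MObs (suc j) = + maxObs (suc j) -ℤ + maxObs j

  IsPDS : Subset n → Set
  IsPDS S = ∣ Obs S ∣ ≡ n

  IsPowerDomNumber : ℕ → Set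
  IsPowerDomNumber g = Σ (Subset n) (λ S → ∣ S ∣ ≡ g × IsPDS S)
                     × (∀ S → IsPDS S → g ≤ ∣ S ∣)

  toℚ : ℕ → ℚ
  toℚ m = + m / 1

  cost : Subset n → ℚ → ℚ
  cost S β = toℚ ∣ S ∣ +ℚ β *ℚ toℚ (n Data.Nat.∸ ∣ Obs S ∣)

  IsBest : Subset n → ℚ → Set
  IsBest S β = ∀ T → cost S β ≤ℚ cost T β

  Useful : Subset n → Set
  Useful S = Σ ℚ λ a → Σ ℚ λ b → 0ℚ ≤ℚ a × a <ℚ b ×
             (∀ β → a ≤ℚ β → β ≤ℚ b → IsBest S β)

  UsefulSize : ℕ → Set
  UsefulSize k = (∀ g → IsPowerDomNumber g → k ≤ g) ×
                 Σ (Subset n) (λ S → ∣ S ∣ ≡ k × Useful S)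

module Submission where

-- Let S be β-best of size i for all β in [a, b] with 0 ≤ a < b, and let T and U attain
-- maxObs at sizes i - 1 and i + 1. Writing u(X) = |V| - |Obs X|, comparing S with T at
-- β = a gives a (u(T) - u(S)) ≥ 1, and comparing S with U at β = b gives
-- b (u(S) - u(U)) ≤ 1. The hypothesis MObs(i) ≤ MObs(i + 1) makes u concave along
-- T, S, U: u(T) - u(S) ≤ u(S) - u(U). Hence 1 ≤ a (u(S) - u(U)) < b (u(S) - u(U)) ≤ 1.

open import Defs
open import Data.Nat using (ℕ; zero; suc; _+_; _∸_; _≤_; _⊔_; z≤n; s≤s)
import Data.Nat.Properties as ℕ
open import Data.Nat.Coprimality using (1-coprimeTo) renaming (sym to coprime-sym)
open import Data.Integer using (+_) renaming (_-_ to _-ℤ_; _+_ to _+ℤ_; _*_ to _*ℤ_; _≤_ to _≤ℤ_)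
import Data.Integer.Properties as ℤ
import Data.Integer.Solver as ℤ-Solver
open import Data.Rational using (ℚ; mkℚ; _/_; 0ℚ; 1ℚ; -_; positive; nonNegative)
  renaming (_+_ to _+ℚ_; _*_ to _*ℚ_; _-_ to _-ℚ_; _≤_ to _≤ℚ_; _<_ to _<ℚ_)
import Data.Rational.Properties as ℚ
open import Data.Rational.Solver using (module +-*-Solver)
open import Data.Bool using (true; false)
open import Data.Vec using ([]; _∷_)
open import Data.Fin.Subset using (Subset; ∣_∣; ⊥)
open import Data.Fin.Subset.Properties using (∣⊥∣≡0; ∣p∣≤n)
open import Data.List using (List; map; filter; foldr)
open import Data.List.Membership.Propositional using (_∈_)
open import Data.List.Membership.Propositional.Properties
  using (∈-map⁺; ∈-filter⁺; ∈-map∘filter⁻; ∈-++⁺ˡ; ∈-++⁺ʳ)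
open import Data.List.Properties using (foldr-preservesᵇ; foldr-preservesᵒ)
open import Data.List.Relation.Unary.All as All using ()
open import Data.List.Relation.Unary.Any as Any using (here)
open import Data.Product using (∃-syntax; _×_; _,_)
open import Data.Sum using (_⊎_; inj₁; inj₂; [_,_])
open import Data.Empty using () renaming (⊥ to Empty)
open import Relation.Nullary using (¬_)
open import Relation.Binary.PropositionalEquality
  using (_≡_; refl; sym; trans; cong; cong₂; subst; subst₂; module ≡-Reasoning)
open import Algebra.Properties.CommutativeSemigroup ℕ.+-commutativeSemigroup using (interchange)

∈⇒≤foldr-⊔ : ∀ {x} {xs : List ℕ} → x ∈ xs → x ≤ foldr _⊔_ 0 xs
∈⇒≤foldr-⊔ {xs = xs} x∈xs =
  foldr-preservesᵒ (λ y z → [ ℕ.m≤n⇒m≤n⊔o z , ℕ.m≤n⇒m≤o⊔n y ]) 0 xs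
    (inj₂ (Any.map (λ { refl → ℕ.≤-refl }) x∈xs))

foldr-⊔-attained : (xs : List ℕ) → foldr _⊔_ 0 xs ≡ 0 ⊎ foldr _⊔_ 0 xs ∈ xs
foldr-⊔-attained xs = foldr-preservesᵇ ⊔-pres (inj₁ refl) (All.tabulate inj₂)
  where
  ⊔-pres : ∀ {y z} → y ≡ 0 ⊎ y ∈ xs → z ≡ 0 ⊎ z ∈ xs → y ⊔ z ≡ 0 ⊎ y ⊔ z ∈ xs
  ⊔-pres {y} {z} py pz with ℕ.⊔-sel y z
  ... | inj₁ y⊔z≡y rewrite y⊔z≡y = py
  ... | inj₂ y⊔z≡z rewrite y⊔z≡z = pz

prefix : ∀ {n} k → k ≤ n → Subset n
prefix zero    _         = ⊥
prefix (suc k) (s≤s k≤n) = true ∷ prefix k k≤n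

∣prefix∣ : ∀ {n} k (k≤n : k ≤ n) → ∣ prefix k k≤n ∣ ≡ k
∣prefix∣ {n} zero _         = ∣⊥∣≡0 n
∣prefix∣     (suc k) (s≤s k≤n) = cong suc (∣prefix∣ k k≤n)

m-n≤o-m⇒m+m≤n+o : ∀ m n o → + m -ℤ + n ≤ℤ + o -ℤ + m → m + m ≤ n + o
m-n≤o-m⇒m+m≤n+o m n o le = ℤ.drop‿+≤+ (subst₂ _≤ℤ_ lhs rhs (ℤ.+-monoˡ-≤ (+ n +ℤ + m) le))
  where
  open ℤ-Solver.+-*-Solver
  lhs : (+ m -ℤ + n) +ℤ (+ n +ℤ + m) ≡ + (m + m)
  lhs = trans (solve 2 (λ m n → (m :- n) :+ (n :+ m) := m :+ m) refl (+ m) (+ n))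
              (sym (ℤ.pos-+ m m))
  rhs : (+ o -ℤ + m) +ℤ (+ n +ℤ + m) ≡ + (n + o)
  rhs = trans (solve 3 (λ m n o → (o :- m) :+ (n :+ m) := n :+ o) refl (+ m) (+ n) (+ o))
              (sym (ℤ.pos-+ n o))

[N∸a]+[N∸b]+[a+b]≡N+N : ∀ {N a b} → a ≤ N → b ≤ N → (N ∸ a) + (N ∸ b) + (a + b) ≡ N + N
[N∸a]+[N∸b]+[a+b]≡N+N {N} {a} {b} a≤N b≤N =
  trans (interchange (N ∸ a) (N ∸ b) a b) (cong₂ _+_ (ℕ.m∸n+n≡m a≤N) (ℕ.m∸n+n≡m b≤N))

∸-+-antimono-≤ : ∀ {N a b c d} → a ≤ N → b ≤ N → c ≤ N → d ≤ N →
                 a + b ≤ c + d → (N ∸ c) + (N ∸ d) ≤ (N ∸ a) + (N ∸ b)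
∸-+-antimono-≤ {N} {a} {b} {c} {d} a≤N b≤N c≤N d≤N a+b≤c+d =
  ℕ.+-cancelʳ-≤ (c + d) _ _ (begin
    (N ∸ c) + (N ∸ d) + (c + d) ≡⟨ [N∸a]+[N∸b]+[a+b]≡N+N c≤N d≤N ⟩
    N + N                       ≡⟨ [N∸a]+[N∸b]+[a+b]≡N+N a≤N b≤N ⟨
    (N ∸ a) + (N ∸ b) + (a + b) ≤⟨ ℕ.+-monoʳ-≤ ((N ∸ a) + (N ∸ b)) a+b≤c+d ⟩
    (N ∸ a) + (N ∸ b) + (c + d) ∎)
  where open ℕ.≤-Reasoning

/1≡mkℚ : ∀ m → + m / 1 ≡ mkℚ (+ m) 0 (coprime-sym (1-coprimeTo m))
/1≡mkℚ m = ℚ.normalize-coprime (coprime-sym (1-coprimeTo m))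

/1-homo-+ : ∀ m k → + (m + k) / 1 ≡ + m / 1 +ℚ + k / 1
/1-homo-+ m k = trans (ℚ./-cong numerator refl) (sym (cong₂ _+ℚ_ (/1≡mkℚ m) (/1≡mkℚ k)))
  where
  numerator : + (m + k) ≡ + m *ℤ + 1 +ℤ + k *ℤ + 1
  numerator = trans (ℤ.pos-+ m k) (sym (cong₂ _+ℤ_ (ℤ.*-identityʳ (+ m)) (ℤ.*-identityʳ (+ k))))

/1-mono-≤ : ∀ {m k} → m ≤ k → + m / 1 ≤ℚ + k / 1
/1-mono-≤ {m} {k} m≤k = begin
  + m / 1                      ≡⟨ ℚ.+-identityʳ (+ m / 1) ⟨
  + m / 1 +ℚ 0ℚ                ≤⟨ ℚ.+-monoʳ-≤ (+ m / 1) 0≤k∸m ⟩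
  + m / 1 +ℚ + (k ∸ m) / 1     ≡⟨ /1-homo-+ m (k ∸ m) ⟨
  + (m + (k ∸ m)) / 1          ≡⟨ cong (λ x → + x / 1) (ℕ.m+[n∸m]≡n m≤k) ⟩
  + k / 1                      ∎
  where
  open ℚ.≤-Reasoning
  0≤k∸m : 0ℚ ≤ℚ + (k ∸ m) / 1
  0≤k∸m = ℚ.nonNegative⁻¹ _ {{ℚ.normalize-nonNeg (k ∸ m) 1}}

+-cancelˡ-≤ : ∀ r {p q} → r +ℚ p ≤ℚ r +ℚ q → p ≤ℚ q
+-cancelˡ-≤ r {p} {q} le = subst₂ _≤ℚ_ (cancel p) (cancel q) (ℚ.+-monoʳ-≤ (- r) le)
  where
  open ≡-Reasoning
  cancel : ∀ x → - r +ℚ (r +ℚ x) ≡ x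
  cancel x = begin
    - r +ℚ (r +ℚ x) ≡⟨ ℚ.+-assoc (- r) r x ⟨
    - r +ℚ r +ℚ x   ≡⟨ cong (_+ℚ x) (ℚ.+-inverseˡ r) ⟩
    0ℚ +ℚ x         ≡⟨ ℚ.+-identityˡ x ⟩
    x               ∎

1≤a*e⇒b*e≤1⇒a≮b : ∀ {a b e} → 0ℚ ≤ℚ a → 1ℚ ≤ℚ a *ℚ e → b *ℚ e ≤ℚ 1ℚ → ¬ (a <ℚ b)
1≤a*e⇒b*e≤1⇒a≮b {a} {b} {e} 0≤a 1≤ae be≤1 a<b = ℚ.<-irrefl refl (begin-strict
  1ℚ      ≤⟨ 1≤ae ⟩
  a *ℚ e  <⟨ ℚ.*-monoˡ-<-pos e {{positive 0<e}} a<b ⟩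
  b *ℚ e  ≤⟨ be≤1 ⟩
  1ℚ      ∎)
  where
  open ℚ.≤-Reasoning
  0<e : 0ℚ <ℚ e
  0<e = ℚ.*-cancelˡ-<-nonNeg a {{nonNegative 0≤a}} (begin-strict
    a *ℚ 0ℚ ≡⟨ ℚ.*-zeroʳ a ⟩
    0ℚ      <⟨ ℚ.positive⁻¹ 1ℚ ⟩
    1ℚ      ≤⟨ 1≤ae ⟩
    a *ℚ e  ∎)

concave⇒¬best-window : ∀ {a b} p q r → 0ℚ ≤ℚ a → a <ℚ b → q + r ≤ p + p →
  1ℚ +ℚ a *ℚ (+ p / 1) ≤ℚ a *ℚ (+ q / 1) →
  b *ℚ (+ p / 1) ≤ℚ 1ℚ +ℚ b *ℚ (+ r / 1) → Empty
concave⇒¬best-window {a} {b} p q r 0≤a a<b q+r≤p+p at-a at-b =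
  1≤a*e⇒b*e≤1⇒a≮b 0≤a 1≤a*e b*e≤1 a<b
  where
  open ℚ.≤-Reasoning
  open +-*-Solver
  P = + p / 1
  Q = + q / 1
  R = + r / 1
  e = P -ℚ R
  Q≤P+P-R : Q ≤ℚ P +ℚ P -ℚ R
  Q≤P+P-R = begin
    Q                  ≡⟨ solve 2 (λ Q R → Q := Q :+ R :- R) refl Q R ⟩
    Q +ℚ R -ℚ R        ≤⟨ ℚ.+-monoˡ-≤ (- R) (subst₂ _≤ℚ_ (/1-homo-+ q r) (/1-homo-+ p p)
                                                 (/1-mono-≤ q+r≤p+p)) ⟩
    P +ℚ P -ℚ R        ∎
  1≤a*e : 1ℚ ≤ℚ a *ℚ e
  1≤a*e = +-cancelˡ-≤ (a *ℚ P) (begin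
    a *ℚ P +ℚ 1ℚ          ≡⟨ ℚ.+-comm (a *ℚ P) 1ℚ ⟩
    1ℚ +ℚ a *ℚ P          ≤⟨ at-a ⟩
    a *ℚ Q                ≤⟨ ℚ.*-monoˡ-≤-nonNeg a {{nonNegative 0≤a}} Q≤P+P-R ⟩
    a *ℚ (P +ℚ P -ℚ R)    ≡⟨ solve 3 (λ a P R → a :* (P :+ P :- R) := a :* P :+ a :* (P :- R))
                                   refl a P R ⟩
    a *ℚ P +ℚ a *ℚ e      ∎)
  b*e≤1 : b *ℚ e ≤ℚ 1ℚ
  b*e≤1 = +-cancelˡ-≤ (b *ℚ R) (begin
    b *ℚ R +ℚ b *ℚ e      ≡⟨ solve 3 (λ b P R → b :* R :+ b :* (P :- R) := b :* P) refl b P R ⟩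
    b *ℚ P                ≤⟨ at-b ⟩
    1ℚ +ℚ b *ℚ R          ≡⟨ ℚ.+-comm 1ℚ (b *ℚ R) ⟩
    b *ℚ R +ℚ 1ℚ          ∎)

module _ (G : Graph) where
  open Graph G using (n)

  ∈-allSubsets : ∀ m (S : Subset m) → S ∈ allSubsets G m
  ∈-allSubsets zero    []        = here refl
  ∈-allSubsets (suc m) (true ∷ S)  = ∈-++⁺ˡ (∈-map⁺ (true ∷_) (∈-allSubsets m S))
  ∈-allSubsets (suc m) (false ∷ S) =
    ∈-++⁺ʳ (map (true ∷_) (allSubsets G m)) (∈-map⁺ (false ∷_) (∈-allSubsets m S))

  ∣Obs∣≤maxObs : ∀ {k} (S : Subset n) → ∣ S ∣ ≡ k → ∣ Obs G S ∣ ≤ maxObs G k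
  ∣Obs∣≤maxObs {k} S ∣S∣≡k = ∈⇒≤foldr-⊔
    (∈-map⁺ (λ T → ∣ Obs G T ∣) (∈-filter⁺ (λ T → ∣ T ∣ ℕ.≟ k) (∈-allSubsets n S) ∣S∣≡k))

  maxObs-attained : ∀ {k} → k ≤ n → ∃[ T ] ∣ T ∣ ≡ k × maxObs G k ≤ ∣ Obs G T ∣
  maxObs-attained {k} k≤n with foldr-⊔-attained (map (λ T → ∣ Obs G T ∣)
                                 (filter (λ T → ∣ T ∣ ℕ.≟ k) (allSubsets G n)))
  ... | inj₁ max≡0 = prefix k k≤n , ∣prefix∣ k k≤n , ℕ.≤-trans (ℕ.≤-reflexive max≡0) z≤n
  ... | inj₂ max∈ with ∈-map∘filter⁻ (λ T → ∣ Obs G T ∣) (λ T → ∣ T ∣ ℕ.≟ k)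
                                        {xs = allSubsets G n} max∈
  ...   | T , _ , max≡∣ObsT∣ , ∣T∣≡k = T , ∣T∣≡k , ℕ.≤-reflexive max≡∣ObsT∣

  unobserved : Subset n → ℕ
  unobserved S = n ∸ ∣ Obs G S ∣

  IsPowerDomNumber⇒≤n : ∀ {g} → IsPowerDomNumber G g → g ≤ n
  IsPowerDomNumber⇒≤n ((S , ∣S∣≡g , _) , _) = subst (_≤ n) ∣S∣≡g (∣p∣≤n S)

  unobserved-concave : ∀ {j} S T U → MObs G (suc j) ≤ℤ MObs G (suc (suc j)) →
    ∣ S ∣ ≡ suc j → maxObs G j ≤ ∣ Obs G T ∣ → maxObs G (suc (suc j)) ≤ ∣ Obs G U ∣ →
    unobserved T + unobserved U ≤ unobserved S + unobserved S
  unobserved-concave {j} S T U mobs ∣S∣≡1+j T-max U-max =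
    ∸-+-antimono-≤ (∣p∣≤n (Obs G S)) (∣p∣≤n (Obs G S)) (∣p∣≤n (Obs G T)) (∣p∣≤n (Obs G U))
      (begin
        ∣ Obs G S ∣ + ∣ Obs G S ∣  ≤⟨ ℕ.+-mono-≤ S≤M₁ S≤M₁ ⟩
        M₁ + M₁                    ≤⟨ m-n≤o-m⇒m+m≤n+o M₁ M₀ M₂ mobs ⟩
        M₀ + M₂                    ≤⟨ ℕ.+-mono-≤ T-max U-max ⟩
        ∣ Obs G T ∣ + ∣ Obs G U ∣  ∎)
    where
    open ℕ.≤-Reasoning
    M₀ = maxObs G j
    M₁ = maxObs G (suc j)
    M₂ = maxObs G (suc (suc j))
    S≤M₁ : ∣ Obs G S ∣ ≤ M₁
    S≤M₁ = ∣Obs∣≤maxObs S ∣S∣≡1+j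

  cost-of-size-suc : ∀ X β {m} → ∣ X ∣ ≡ suc m →
    cost G X β ≡ + m / 1 +ℚ (1ℚ +ℚ β *ℚ (+ unobserved X / 1))
  cost-of-size-suc X β {m} ∣X∣≡1+m = begin
    + ∣ X ∣ / 1 +ℚ βu        ≡⟨ cong (λ s → + s / 1 +ℚ βu) ∣X∣≡1+m ⟩
    + suc m / 1 +ℚ βu        ≡⟨ cong (_+ℚ βu) (/1-homo-+ 1 m) ⟩
    1ℚ +ℚ + m / 1 +ℚ βu      ≡⟨ solve 2 (λ x y → con 1ℚ :+ x :+ y := x :+ (con 1ℚ :+ y))
                                        refl (+ m / 1) βu ⟩
    + m / 1 +ℚ (1ℚ +ℚ βu)    ∎
    where
    open ≡-Reasoning
    open +-*-Solver
    βu = β *ℚ (+ unobserved X / 1)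

  best-against-one-smaller : ∀ S T β → IsBest G S β → ∣ S ∣ ≡ suc ∣ T ∣ →
    1ℚ +ℚ β *ℚ (+ unobserved S / 1) ≤ℚ β *ℚ (+ unobserved T / 1)
  best-against-one-smaller S T β best ∣S∣≡1+∣T∣ = +-cancelˡ-≤ (+ ∣ T ∣ / 1)
    (subst (_≤ℚ cost G T β) (cost-of-size-suc S β ∣S∣≡1+∣T∣) (best T))

  best-against-one-larger : ∀ S T β → IsBest G S β → ∣ T ∣ ≡ suc ∣ S ∣ →
    β *ℚ (+ unobserved S / 1) ≤ℚ 1ℚ +ℚ β *ℚ (+ unobserved T / 1)
  best-against-one-larger S T β best ∣T∣≡1+∣S∣ = +-cancelˡ-≤ (+ ∣ S ∣ / 1)
    (subst (cost G S β ≤ℚ_) (cost-of-size-suc T β ∣T∣≡1+∣S∣) (best T))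

proposition3p2 : (G : Graph) (g i : ℕ) → IsPowerDomNumber G g →
    1 ≤ i → suc i ≤ g → MObs G i ≤ℤ MObs G (suc i) → ¬ UsefulSize G i
proposition3p2 G g (suc j) γ (s≤s z≤n) 2+j≤g mobs (_ , S , ∣S∣≡1+j , a , b , 0≤a , a<b , best)
  with maxObs-attained G (ℕ.m+n≤o⇒n≤o 2 2+j≤n) | maxObs-attained G 2+j≤n
  where 2+j≤n = ℕ.≤-trans 2+j≤g (IsPowerDomNumber⇒≤n G γ)
... | T , ∣T∣≡j , T-max | U , ∣U∣≡2+j , U-max =
  concave⇒¬best-window (unobserved G S) (unobserved G T) (unobserved G U) 0≤a a<b
    (unobserved-concave G S T U mobs ∣S∣≡1+j T-max U-max)
    (best-against-one-smaller G S T a (best a ℚ.≤-refl (ℚ.<⇒≤ a<b))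
      (trans ∣S∣≡1+j (cong suc (sym ∣T∣≡j))))
    (best-against-one-larger G S U b (best b (ℚ.<⇒≤ a<b) ℚ.≤-refl)
      (trans ∣U∣≡2+j (cong suc (sym ∣S∣≡1+j))))
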